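{- Let $T$ be a monad on a locally small category $\mathbf{C}$ with free–forgetful adjunction $L\dashv R$ ($LX=(TX,\mu_X)$), $F\colon\mathbf{C}\to\mathbf{C}$ a functor, $\zeta\colon TF\Rightarrow FT$ a distributive law (EM-law) with induced lifting $\tilde F$ on $\mathrm{EM}(T)$, $c\colon X\to FTX$ a coalgebra in $\mathbf{C}$ and $c^\#=F\mu_X\circ\zeta_{TX}\circ Tc\colon LX\to\tilde FLX$ its determinization. Let $\Psi\colon\mathbf{C}^{\mathrm{op}}\to\mathbf{Pos}$ have fibres with arbitrary meets preserved by reindexing, $\Phi=\Psi\circ R$, $(\Omega,o)$ a $T$-algebra and $d_\Omega\in\Psi\Omega$; for a $T$-algebra $Y$ define $\alpha_Y(S)=\bigwedge_{k\in S}k^*(d_\Omega)$ and $\gamma_Y(d)=\{k\in\mathrm{EM}(T)(Y,(\Omega,o))\mid d\preceq k^*(d_\Omega)\}$ (reindexing in $\Phi$), $\mathrm{cl}_Y=\gamma_Y\circ\alpha_Y$. Let $(\mathrm{ev}_\lambda\colon\tilde F(\Omega,o)\to(\Omega,o))_{\lambda\in\Lambda}$ be homomorphisms, $\Lambda_Y(S)=\{\mathrm{ev}_\lambda\circ\tilde Fh\mid\lambda\in\Lambda,h\in S\}$, and assume $\Lambda_{LX}(\mathrm{cl}_{LX}(S))\subseteq\mathrm{cl}_{\tilde FLX}(\Lambda_{LX}(S))$ for all $S$. Fix $\Theta_{LX}\subseteq\mathrm{EM}(T)(LX,(\Omega,o))$. Then: (1) $\mathrm{lo}_{LX}(S)=\mathcal{P}((c^\#)^\bullet)(\Lambda_{LX}(S))\cup\Theta_{LX}$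 is $\mathrm{cl}_{LX}$-compatible, i.e. $\mathrm{lo}_{LX}(\mathrm{cl}_{LX}(S))\subseteq\mathrm{cl}_{LX}(\mathrm{lo}_{LX}(S))$; (2) with $K_{LX}=\alpha_{\tilde FLX}\circ\Lambda_{LX}\circ\gamma_{LX}$ and $\mathrm{be}_{LX}(d)=(c^\#)^*(K_{LX}(d))\wedge\alpha_{LX}(\Theta_{LX})$, we have $\alpha_{LX}(\mu\,\mathrm{lo}_{LX})=\nu\,\mathrm{be}_{LX}$; (3) let $\alpha'_X\colon\mathcal{P}(\mathbf{C}(X,\Omega))\to\mathcal{P}(\mathrm{EM}(T)(LX,(\Omega,o)))$ be the bijection induced by $h\mapsto o\circ Th$, with inverse $\gamma'_X$, let $\Lambda'_X(S)=\{\mathrm{ev}_\lambda\circ Fo\circ FTh\mid\lambda\in\Lambda,h\in S\}\subseteq\mathbf{C}(FTX,\Omega)$, let $\Theta'_X\subseteq\mathbf{C}(X,\Omega)$ with $\Theta_{LX}=\alpha'_X(\Theta'_X)$, and $\mathrm{lo}'_X(S)=\mathcal{P}(c^\bullet)(\Lambda'_X(S))\cup\Theta'_X$. Then $\alpha'_X\circ\mathrm{lo}'_X\circ\gamma'_X=\mathrm{lo}_{LX}$ and $\alpha_{LX}(\alpha'_X(\mu\,\mathrm{lo}'_X))=\nu\,\mathrm{be}_{LX}$.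
   Context: $\mathrm{EM}(T)$ is the Eilenberg–Moore category of $T$; an EM-law satisfies $\zeta_X\circ\eta_{FX}=F\eta_X$ and $\zeta_X\circ\mu_{FX}=F\mu_X\circ\zeta_{TX}\circ T\zeta_X$, and $\tilde F(A,a)=(FA,Fa\circ\zeta_A)$. $(c^\#)^\bullet$ and $c^\bullet$ denote precomposition on morphisms into $\Omega$, $\mathcal{P}(-)$ their direct images, and $(c^\#)^*=\Phi(c^\#)$. $\mu\,\mathrm{lo}$ denotes the least fixpoint w.r.t. inclusion; $\nu\,\mathrm{be}$ the greatest fixpoint w.r.t. $\preceq$ in $\Phi(LX)=\Psi(TX)$. -}

module Defs where

open import Level using (Level; _⊔_; Lift; lift) renaming (suc to lsuc)
open import Relation.Binary.PropositionalEquality using (_≡_)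
open import Data.Product using (Σ; _×_; _,_)
open import Data.Sum using (_⊎_)
open import Data.Bool using (Bool; true; false)

record Category (o ℓ : Level) : Set (lsuc (o ⊔ ℓ)) where
  infixr 9 _∘_
  field
    Obj : Set o
    Hom : Obj → Obj → Set ℓ
    id  : ∀ {A} → Hom A A
    _∘_ : ∀ {A B D} → Hom B D → Hom A B → Hom A D
    identityˡ : ∀ {A B} {f : Hom A B} → id ∘ f ≡ f
    identityʳ : ∀ {A B} {f : Hom A B} → f ∘ id ≡ f
    assoc : ∀ {A B D E} {f : Hom A B} {g : Hom B D} {h : Hom D E} →
            (h ∘ g) ∘ f ≡ h ∘ (g ∘ f)

record Endofunctor {o ℓ} (C : Category o ℓ) : Set (o ⊔ ℓ) where
  open Category C
  field
    F₀ : Obj → Obj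
    F₁ : ∀ {A B} → Hom A B → Hom (F₀ A) (F₀ B)
    F-id : ∀ {A} → F₁ (id {A}) ≡ id
    F-∘ : ∀ {A B D} (f : Hom A B) (g : Hom B D) → F₁ (g ∘ f) ≡ F₁ g ∘ F₁ f

record Monad {o ℓ} (C : Category o ℓ) : Set (o ⊔ ℓ) where
  open Category C
  field
    T : Endofunctor C
  T₀ = Endofunctor.F₀ T
  T₁ : ∀ {A B} → Hom A B → Hom (T₀ A) (T₀ B)
  T₁ = Endofunctor.F₁ T
  field
    η : ∀ X → Hom X (T₀ X)
    μ : ∀ X → Hom (T₀ (T₀ X)) (T₀ X)
    η-natural : ∀ {X Y} (f : Hom X Y) → η Y ∘ f ≡ T₁ f ∘ η X
    μ-natural : ∀ {X Y} (f : Hom X Y) → μ Y ∘ T₁ (T₁ f) ≡ T₁ f ∘ μ X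
    μ-assoc : ∀ X → μ X ∘ T₁ (μ X) ≡ μ X ∘ μ (T₀ X)
    μ-identityˡ : ∀ X → μ X ∘ T₁ (η X) ≡ id
    μ-identityʳ : ∀ X → μ X ∘ η (T₀ X) ≡ id

record EMLaw {o ℓ} {C : Category o ℓ} (M : Monad C) (F : Endofunctor C) : Set (o ⊔ ℓ) where
  open Category C
  open Monad M
  open Endofunctor F
  field
    ζ : ∀ X → Hom (T₀ (F₀ X)) (F₀ (T₀ X))
    ζ-natural : ∀ {X Y} (f : Hom X Y) → ζ Y ∘ T₁ (F₁ f) ≡ F₁ (T₁ f) ∘ ζ X
    ζ-η : ∀ X → ζ X ∘ η (F₀ X) ≡ F₁ (η X)
    ζ-μ : ∀ X → ζ X ∘ μ (F₀ X) ≡ F₁ (μ X) ∘ (ζ (T₀ X) ∘ T₁ (ζ X))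

-- Ψ : C^op → Pos, fibres with arbitrary (Set ℓ-indexed) meets,
-- preserved by reindexing.
record MeetFibration {o ℓ} (C : Category o ℓ) (p : Level) : Set (o ⊔ lsuc ℓ ⊔ lsuc p) where
  open Category C
  field
    P : Obj → Set p
    _≼_ : ∀ {X} → P X → P X → Set ℓ
    ≼-refl : ∀ {X} {d : P X} → d ≼ d
    ≼-trans : ∀ {X} {d e f : P X} → d ≼ e → e ≼ f → d ≼ f
    ≼-antisym : ∀ {X} {d e : P X} → d ≼ e → e ≼ d → d ≡ e
    reindex : ∀ {X Y} → Hom X Y → P Y → P X
    reindex-mono : ∀ {X Y} (f : Hom X Y) {d e : P Y} → d ≼ e → reindex f d ≼ reindex f e
    reindex-id : ∀ {X} (d : P X) → reindex id d ≡ d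
    reindex-∘ : ∀ {X Y Z} (f : Hom X Y) (g : Hom Y Z) (d : P Z) →
                reindex (g ∘ f) d ≡ reindex f (reindex g d)
    ⋀ : ∀ {X} {I : Set ℓ} → (I → P X) → P X
    ⋀-lower : ∀ {X} {I : Set ℓ} (f : I → P X) (i : I) → ⋀ f ≼ f i
    ⋀-greatest : ∀ {X} {I : Set ℓ} (f : I → P X) (d : P X) →
                 (∀ i → d ≼ f i) → d ≼ ⋀ f
    reindex-⋀ : ∀ {X Y} (g : Hom X Y) {I : Set ℓ} (f : I → P Y) →
                reindex g (⋀ f) ≡ ⋀ (λ i → reindex g (f i))

module Theory {o ℓ p} (C : Category o ℓ) (M : Monad C) (Fn : Endofunctor C)
  (Z : EMLaw M Fn) (Ψ : MeetFibration C p)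
  (Ω : Category.Obj C) (oΩ : Category.Hom C (Monad.T₀ M Ω) Ω)
  (dΩ : MeetFibration.P Ψ Ω)
  (Λ : Set ℓ) (ev : Λ → Category.Hom C (Endofunctor.F₀ Fn Ω) Ω)
  (X : Category.Obj C) (c : Category.Hom C X (Endofunctor.F₀ Fn (Monad.T₀ M X))) where

  open Category C
  open Monad M
  open Endofunctor Fn
  open EMLaw Z
  open MeetFibration Ψ

  Sub : Set ℓ → Set (lsuc ℓ)
  Sub A = A → Set ℓ

  _⊆_ : ∀ {A : Set ℓ} → Sub A → Sub A → Set ℓ
  S ⊆ S' = ∀ x → S x → S' x

  _≐_ : ∀ {A : Set ℓ} → Sub A → Sub A → Set ℓ
  S ≐ S' = (S ⊆ S') × (S' ⊆ S)

  IsAlg : ∀ {A} → Hom (T₀ A) A → Set ℓ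
  IsAlg {A} a = (a ∘ η A ≡ id) × (a ∘ μ A ≡ a ∘ T₁ a)

  IsHom : ∀ {A B} → Hom (T₀ A) A → Hom (T₀ B) B → Hom A B → Set ℓ
  IsHom a b h = h ∘ a ≡ b ∘ T₁ h

  -- structure map of the lifting F̃(A,a) = (FA, Fa ∘ ζ_A)
  F̃str : ∀ {A} → Hom (T₀ A) A → Hom (T₀ (F₀ A)) (F₀ A)
  F̃str {A} a = F₁ a ∘ ζ A

  c# : Hom (T₀ X) (F₀ (T₀ X))
  c# = F₁ (μ X) ∘ (ζ (T₀ X) ∘ T₁ c)

  -- EM(LX,(Ω,o)) as the subset of C(TX,Ω) of homomorphisms
  HomsL : Sub (Hom (T₀ X) Ω)
  HomsL = IsHom (μ X) oΩ

  α : ∀ {A} → Sub (Hom A Ω) → P A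
  α {A} S = ⋀ {I = Σ (Hom A Ω) S} (λ { (k , _) → reindex k dΩ })

  γ : ∀ {A} → Hom (T₀ A) A → P A → Sub (Hom A Ω)
  γ y d k = IsHom y oΩ k × (d ≼ reindex k dΩ)

  cl : ∀ {A} → Hom (T₀ A) A → Sub (Hom A Ω) → Sub (Hom A Ω)
  cl y S = γ y (α S)

  ΛL : Sub (Hom (T₀ X) Ω) → Sub (Hom (F₀ (T₀ X)) Ω)
  ΛL S g = Σ Λ λ l → Σ (Hom (T₀ X) Ω) λ h → S h × (g ≡ ev l ∘ F₁ h)

  lo : Sub (Hom (T₀ X) Ω) → Sub (Hom (T₀ X) Ω) → Sub (Hom (T₀ X) Ω)
  lo Θ S k = (Σ (Hom (F₀ (T₀ X)) Ω) λ g → ΛL S g × (k ≡ g ∘ c#)) ⊎ Θ k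

  _∧_ : ∀ {A} → P A → P A → P A
  d ∧ e = ⋀ {I = Lift ℓ Bool} (λ { (lift true) → d ; (lift false) → e })

  K : P (T₀ X) → P (F₀ (T₀ X))
  K d = α (ΛL (γ (μ X) d))

  be : Sub (Hom (T₀ X) Ω) → P (T₀ X) → P (T₀ X)
  be Θ d = reindex c# (K d) ∧ α Θ

  α' : Sub (Hom X Ω) → Sub (Hom (T₀ X) Ω)
  α' S k = Σ (Hom X Ω) λ h → S h × (k ≡ oΩ ∘ T₁ h)

  γ' : Sub (Hom (T₀ X) Ω) → Sub (Hom X Ω)
  γ' S h = S (oΩ ∘ T₁ h)

  Λ' : Sub (Hom X Ω) → Sub (Hom (F₀ (T₀ X)) Ω)
  Λ' S g = Σ Λ λ l → Σ (Hom X Ω) λ h → S h × (g ≡ ev l ∘ (F₁ oΩ ∘ F₁ (T₁ h)))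

  lo' : Sub (Hom X Ω) → Sub (Hom X Ω) → Sub (Hom X Ω)
  lo' Θ' S h = (Σ (Hom (F₀ (T₀ X)) Ω) λ g → Λ' S g × (h ≡ g ∘ c)) ⊎ Θ' h

  IsLfpL : (Sub (Hom (T₀ X) Ω) → Sub (Hom (T₀ X) Ω)) → Sub (Hom (T₀ X) Ω) → Set (lsuc ℓ)
  IsLfpL f S = (S ⊆ HomsL) × (f S ≐ S) ×
               (∀ S' → S' ⊆ HomsL → f S' ≐ S' → S ⊆ S')

  IsLfp : (Sub (Hom X Ω) → Sub (Hom X Ω)) → Sub (Hom X Ω) → Set (lsuc ℓ)
  IsLfp f S = (f S ≐ S) × (∀ S' → f S' ≐ S' → S ⊆ S')

  IsGfp : (P (T₀ X) → P (T₀ X)) → P (T₀ X) → Set (ℓ ⊔ p)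
  IsGfp f d = (f d ≡ d) × (∀ d' → f d' ≡ d' → d' ≼ d)

-- Write α ⊣ γ for the Galois connection between subsets of homomorphisms and
-- predicates. Then be is sandwiched between α ∘ lo ∘ γ and α ∘ lo:
-- be d ≼ α (lo (γ d)) always, and α (lo S) ≼ be (α S) by the compatibility
-- hypothesis on Λ. Composing the two at d = α S gives (1). For (2), α maps the
-- least fixpoint of lo to a fixpoint of be, and every fixpoint d of be makes
-- γ d closed under lo, hence contains the least fixpoint, so d ≼ α (μ lo).
-- For (3), h ↦ o ∘ T h is a bijection C(X, Ω) ≅ EM(LX, (Ω, o)) that
-- intertwines lo' with lo, so it carries least fixpoints to least fixpoints.
module Submission where

open import Defs
open import Level using (Level; lift)
open import Data.Product using (_×_; Σ; _,_; proj₁; proj₂)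
open import Data.Sum using (inj₁; inj₂)
open import Data.Bool using (true; false)
open import Relation.Binary.PropositionalEquality

module Proof {o ℓ p : Level} (C : Category o ℓ) (M : Monad C) (Fn : Endofunctor C)
    (Z : EMLaw M Fn) (Ψ : MeetFibration C p)
    (Ω : Category.Obj C) (oΩ : Category.Hom C (Monad.T₀ M Ω) Ω)
    (dΩ : MeetFibration.P Ψ Ω)
    (Λ : Set ℓ) (ev : Λ → Category.Hom C (Endofunctor.F₀ Fn Ω) Ω)
    (X : Category.Obj C) (c : Category.Hom C X (Endofunctor.F₀ Fn (Monad.T₀ M X))) where
  open Theory C M Fn Z Ψ Ω oΩ dΩ Λ ev X c
  open Category C
  open Monad M
  open Endofunctor Fn
  open EMLaw Z
  open MeetFibration Ψ
  open ≡-Reasoning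

  ⊆-trans : ∀ {A : Set ℓ} {S S' S'' : Sub A} → S ⊆ S' → S' ⊆ S'' → S ⊆ S''
  ⊆-trans f g x s = g x (f x s)

  T-∘ : ∀ {A B D} (f : Hom A B) (g : Hom B D) → T₁ (g ∘ f) ≡ T₁ g ∘ T₁ f
  T-∘ = Endofunctor.F-∘ T

  IsHom-∘ : ∀ {A B D} {a : Hom (T₀ A) A} {b : Hom (T₀ B) B} {d : Hom (T₀ D) D}
            {f : Hom A B} {g : Hom B D} → IsHom a b f → IsHom b d g → IsHom a d (g ∘ f)
  IsHom-∘ {a = a} {b} {d} {f} {g} hf hg = begin
    (g ∘ f) ∘ a        ≡⟨ assoc ⟩
    g ∘ (f ∘ a)        ≡⟨ cong (g ∘_) hf ⟩
    g ∘ (b ∘ T₁ f)     ≡⟨ sym assoc ⟩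
    (g ∘ b) ∘ T₁ f     ≡⟨ cong (_∘ T₁ f) hg ⟩
    (d ∘ T₁ g) ∘ T₁ f  ≡⟨ assoc ⟩
    d ∘ (T₁ g ∘ T₁ f)  ≡⟨ cong (d ∘_) (sym (T-∘ f g)) ⟩
    d ∘ T₁ (g ∘ f)     ∎

  μ-isAlg : ∀ A → IsAlg (μ A)
  μ-isAlg A = μ-identityʳ A , sym (μ-assoc A)

  F̃-isAlg : ∀ {A} {a : Hom (T₀ A) A} → IsAlg a → IsAlg (F̃str a)
  F̃-isAlg {A} {a} (a-η , a-μ) = unit , mult
    where
    unit : (F₁ a ∘ ζ A) ∘ η (F₀ A) ≡ id
    unit = begin
      (F₁ a ∘ ζ A) ∘ η (F₀ A)  ≡⟨ assoc ⟩
      F₁ a ∘ (ζ A ∘ η (F₀ A))  ≡⟨ cong (F₁ a ∘_) (ζ-η A) ⟩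
      F₁ a ∘ F₁ (η A)          ≡⟨ sym (F-∘ (η A) a) ⟩
      F₁ (a ∘ η A)             ≡⟨ cong F₁ a-η ⟩
      F₁ id                    ≡⟨ F-id ⟩
      id                       ∎
    mult : (F₁ a ∘ ζ A) ∘ μ (F₀ A) ≡ (F₁ a ∘ ζ A) ∘ T₁ (F₁ a ∘ ζ A)
    mult = begin
      (F₁ a ∘ ζ A) ∘ μ (F₀ A)                           ≡⟨ assoc ⟩
      F₁ a ∘ (ζ A ∘ μ (F₀ A))                           ≡⟨ cong (F₁ a ∘_) (ζ-μ A) ⟩
      F₁ a ∘ (F₁ (μ A) ∘ (ζ (T₀ A) ∘ T₁ (ζ A)))         ≡⟨ sym assoc ⟩
      (F₁ a ∘ F₁ (μ A)) ∘ (ζ (T₀ A) ∘ T₁ (ζ A))         ≡⟨ cong (_∘ (ζ (T₀ A) ∘ T₁ (ζ A))) F-a-μ ⟩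
      (F₁ a ∘ F₁ (T₁ a)) ∘ (ζ (T₀ A) ∘ T₁ (ζ A))        ≡⟨ assoc ⟩
      F₁ a ∘ (F₁ (T₁ a) ∘ (ζ (T₀ A) ∘ T₁ (ζ A)))        ≡⟨ cong (F₁ a ∘_) (sym assoc) ⟩
      F₁ a ∘ ((F₁ (T₁ a) ∘ ζ (T₀ A)) ∘ T₁ (ζ A))        ≡⟨ cong (λ z → F₁ a ∘ (z ∘ T₁ (ζ A))) (sym (ζ-natural a)) ⟩
      F₁ a ∘ ((ζ A ∘ T₁ (F₁ a)) ∘ T₁ (ζ A))             ≡⟨ cong (F₁ a ∘_) assoc ⟩
      F₁ a ∘ (ζ A ∘ (T₁ (F₁ a) ∘ T₁ (ζ A)))             ≡⟨ sym assoc ⟩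
      (F₁ a ∘ ζ A) ∘ (T₁ (F₁ a) ∘ T₁ (ζ A))             ≡⟨ cong ((F₁ a ∘ ζ A) ∘_) (sym (T-∘ (ζ A) (F₁ a))) ⟩
      (F₁ a ∘ ζ A) ∘ T₁ (F₁ a ∘ ζ A)                    ∎
      where
      F-a-μ : F₁ a ∘ F₁ (μ A) ≡ F₁ a ∘ F₁ (T₁ a)
      F-a-μ = trans (sym (F-∘ (μ A) a)) (trans (cong F₁ a-μ) (F-∘ (T₁ a) a))

  F̃-isHom : ∀ {A B} {a : Hom (T₀ A) A} {b : Hom (T₀ B) B} {h : Hom A B} →
            IsHom a b h → IsHom (F̃str a) (F̃str b) (F₁ h)
  F̃-isHom {A} {B} {a} {b} {h} hh = begin
    F₁ h ∘ (F₁ a ∘ ζ A)        ≡⟨ sym assoc ⟩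
    (F₁ h ∘ F₁ a) ∘ ζ A        ≡⟨ cong (_∘ ζ A) F-hh ⟩
    (F₁ b ∘ F₁ (T₁ h)) ∘ ζ A   ≡⟨ assoc ⟩
    F₁ b ∘ (F₁ (T₁ h) ∘ ζ A)   ≡⟨ cong (F₁ b ∘_) (sym (ζ-natural h)) ⟩
    F₁ b ∘ (ζ B ∘ T₁ (F₁ h))   ≡⟨ sym assoc ⟩
    (F₁ b ∘ ζ B) ∘ T₁ (F₁ h)   ∎
    where
    F-hh : F₁ h ∘ F₁ a ≡ F₁ b ∘ F₁ (T₁ h)
    F-hh = trans (sym (F-∘ a h)) (trans (cong F₁ hh) (F-∘ (T₁ h) b))

  -- b ∘ T₁ f is the homomorphic extension of f : A → B along η, i.e. the
  -- transpose of f under L ⊣ R.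

  extend-isHom : ∀ {A B} {b : Hom (T₀ B) B} → IsAlg b → (f : Hom A B) →
                 IsHom (μ A) b (b ∘ T₁ f)
  extend-isHom {A} {B} {b} (_ , b-μ) f = begin
    (b ∘ T₁ f) ∘ μ A         ≡⟨ assoc ⟩
    b ∘ (T₁ f ∘ μ A)         ≡⟨ cong (b ∘_) (sym (μ-natural f)) ⟩
    b ∘ (μ B ∘ T₁ (T₁ f))    ≡⟨ sym assoc ⟩
    (b ∘ μ B) ∘ T₁ (T₁ f)    ≡⟨ cong (_∘ T₁ (T₁ f)) b-μ ⟩
    (b ∘ T₁ b) ∘ T₁ (T₁ f)   ≡⟨ assoc ⟩
    b ∘ (T₁ b ∘ T₁ (T₁ f))   ≡⟨ cong (b ∘_) (sym (T-∘ (T₁ f) b)) ⟩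
    b ∘ T₁ (b ∘ T₁ f)        ∎

  extend-∘-η : ∀ {A B} {b : Hom (T₀ B) B} → IsAlg b → (f : Hom A B) →
               (b ∘ T₁ f) ∘ η A ≡ f
  extend-∘-η {A} {B} {b} (b-η , _) f = begin
    (b ∘ T₁ f) ∘ η A   ≡⟨ assoc ⟩
    b ∘ (T₁ f ∘ η A)   ≡⟨ cong (b ∘_) (sym (η-natural f)) ⟩
    b ∘ (η B ∘ f)      ≡⟨ sym assoc ⟩
    (b ∘ η B) ∘ f      ≡⟨ cong (_∘ f) b-η ⟩
    id ∘ f             ≡⟨ identityˡ ⟩
    f                  ∎

  extend-injective : ∀ {A B} {b : Hom (T₀ B) B} → IsAlg b → {f f' : Hom A B} →
                     b ∘ T₁ f ≡ b ∘ T₁ f' → f ≡ f'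
  extend-injective {A} isAlg {f} {f'} e =
    trans (sym (extend-∘-η isAlg f)) (trans (cong (_∘ η A) e) (extend-∘-η isAlg f'))

  extend-restrict : ∀ {A B} {b : Hom (T₀ B) B} {k : Hom (T₀ A) B} →
                    IsHom (μ A) b k → b ∘ T₁ (k ∘ η A) ≡ k
  extend-restrict {A} {b = b} {k} hk = begin
    b ∘ T₁ (k ∘ η A)          ≡⟨ cong (b ∘_) (T-∘ (η A) k) ⟩
    b ∘ (T₁ k ∘ T₁ (η A))     ≡⟨ sym assoc ⟩
    (b ∘ T₁ k) ∘ T₁ (η A)     ≡⟨ cong (_∘ T₁ (η A)) (sym hk) ⟩
    (k ∘ μ A) ∘ T₁ (η A)      ≡⟨ assoc ⟩
    k ∘ (μ A ∘ T₁ (η A))      ≡⟨ cong (k ∘_) (μ-identityˡ A) ⟩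
    k ∘ id                    ≡⟨ identityʳ ⟩
    k                         ∎

  extend-natural : ∀ {A B D} {b : Hom (T₀ B) B} {d : Hom (T₀ D) D} {g : Hom B D} →
                   IsHom b d g → (f : Hom A B) → d ∘ T₁ (g ∘ f) ≡ g ∘ (b ∘ T₁ f)
  extend-natural {b = b} {d} {g} hg f = begin
    d ∘ T₁ (g ∘ f)       ≡⟨ cong (d ∘_) (T-∘ f g) ⟩
    d ∘ (T₁ g ∘ T₁ f)    ≡⟨ sym assoc ⟩
    (d ∘ T₁ g) ∘ T₁ f    ≡⟨ cong (_∘ T₁ f) (sym hg) ⟩
    (g ∘ b) ∘ T₁ f       ≡⟨ assoc ⟩
    g ∘ (b ∘ T₁ f)       ∎

  c#-extends-c : F̃str (μ X) ∘ T₁ c ≡ c#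
  c#-extends-c = assoc

  c#-isHom : IsHom (μ X) (F̃str (μ X)) c#
  c#-isHom = subst (IsHom (μ X) (F̃str (μ X))) c#-extends-c
                   (extend-isHom (F̃-isAlg (μ-isAlg X)) c)

  α-lower : ∀ {A} (S : Sub (Hom A Ω)) {k} → S k → α S ≼ reindex k dΩ
  α-lower S {k} s = ⋀-lower _ (k , s)

  ⊆γ⇒≼α : ∀ {A} {y : Hom (T₀ A) A} {S : Sub (Hom A Ω)} {d} → S ⊆ γ y d → d ≼ α S
  ⊆γ⇒≼α {d = d} S⊆γd = ⋀-greatest _ d (λ { (k , s) → proj₂ (S⊆γd k s) })

  ≼α⇒⊆γ : ∀ {A} {y : Hom (T₀ A) A} {S : Sub (Hom A Ω)} {d} →
          S ⊆ IsHom y oΩ → d ≼ α S → S ⊆ γ y d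
  ≼α⇒⊆γ {S = S} S-homs d≼αS k s = S-homs k s , ≼-trans d≼αS (α-lower S s)

  α-antitone : ∀ {A} {S S' : Sub (Hom A Ω)} → S ⊆ S' → α S' ≼ α S
  α-antitone {S' = S'} S⊆S' = ⋀-greatest _ _ (λ { (k , s) → α-lower S' (S⊆S' k s) })

  ⊆-cl : ∀ {A} {y : Hom (T₀ A) A} {S : Sub (Hom A Ω)} → S ⊆ IsHom y oΩ → S ⊆ cl y S
  ⊆-cl S-homs = ≼α⇒⊆γ S-homs ≼-refl

  ∧-lowerˡ : ∀ {A} {d e : P A} → (d ∧ e) ≼ d
  ∧-lowerˡ = ⋀-lower _ (lift true)

  ∧-lowerʳ : ∀ {A} {d e : P A} → (d ∧ e) ≼ e
  ∧-lowerʳ = ⋀-lower _ (lift false)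

  ∧-greatest : ∀ {A} {d e f : P A} → f ≼ d → f ≼ e → f ≼ (d ∧ e)
  ∧-greatest {f = f} f≼d f≼e = ⋀-greatest _ f (λ { (lift true) → f≼d ; (lift false) → f≼e })

  reindex-≼-∘ : ∀ {A B} (f : Hom A B) {d : P B} (g : Hom B Ω) → d ≼ reindex g dΩ →
                reindex f d ≼ reindex (g ∘ f) dΩ
  reindex-≼-∘ f {d} g d≼g* = subst (reindex f d ≼_) (sym (reindex-∘ f g dΩ)) (reindex-mono f d≼g*)

  α-≼-reindex-α : ∀ {A B} (f : Hom A B) {S : Sub (Hom A Ω)} {U : Sub (Hom B Ω)} →
                  (∀ g → U g → S (g ∘ f)) → α S ≼ reindex f (α U)
  α-≼-reindex-α f {S} U∘f⊆S = subst (α S ≼_) (sym (reindex-⋀ f _))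
    (⋀-greatest _ _ (λ { (g , u) → subst (α S ≼_) (reindex-∘ f g dΩ) (α-lower S (U∘f⊆S g u)) }))

  lo-mono : ∀ {Θ S S'} → S ⊆ S' → lo Θ S ⊆ lo Θ S'
  lo-mono S⊆S' k (inj₁ (g , (l , h , s , g≡) , k≡)) = inj₁ (g , (l , h , S⊆S' h s , g≡) , k≡)
  lo-mono S⊆S' k (inj₂ θ) = inj₂ θ

  be-≼-α-lo-γ : ∀ Θ d → be Θ d ≼ α (lo Θ (γ (μ X) d))
  be-≼-α-lo-γ Θ d = ⋀-greatest _ _ bound
    where
    bound : ((k , _) : Σ (Hom (T₀ X) Ω) (lo Θ (γ (μ X) d))) → be Θ d ≼ reindex k dΩ
    bound (k , inj₂ θ) = ≼-trans ∧-lowerʳ (α-lower Θ θ)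
    bound (.(g ∘ c#) , inj₁ (g , g∈Λγd , refl)) =
      ≼-trans ∧-lowerˡ (reindex-≼-∘ c# g (α-lower (ΛL (γ (μ X) d)) g∈Λγd))

  -- Leastness in IsLfpL is only among fixpoints, not lo-closed sets; the
  -- inductively generated fixpoint Lo bridges the two.
  data Lo (Θ : Sub (Hom (T₀ X) Ω)) : Sub (Hom (T₀ X) Ω) where
    roll : ∀ {k} → lo Θ (Lo Θ) k → Lo Θ k

  Lo-fixpoint : ∀ Θ → lo Θ (Lo Θ) ≐ Lo Θ
  Lo-fixpoint Θ = (λ _ → roll) , (λ { _ (roll x) → x })

  Lo-least : ∀ {Θ S} → lo Θ S ⊆ S → Lo Θ ⊆ S
  Lo-least closed k (roll (inj₂ θ)) = closed k (inj₂ θ)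
  Lo-least closed k (roll (inj₁ (g , (l , h , h∈Lo , g≡) , k≡))) =
    closed k (inj₁ (g , (l , h , Lo-least closed h h∈Lo , g≡) , k≡))

  module Homomorphisms (evh : ∀ l → IsHom (F̃str oΩ) oΩ (ev l))
    (Θ : Sub (Hom (T₀ X) Ω)) (Θ-homs : Θ ⊆ HomsL) where

    lo-homs : ∀ {S} → S ⊆ HomsL → lo Θ S ⊆ HomsL
    lo-homs S-homs k (inj₂ θ) = Θ-homs k θ
    lo-homs S-homs .((ev l ∘ F₁ h) ∘ c#) (inj₁ (.(ev l ∘ F₁ h) , (l , h , s , refl) , refl)) =
      IsHom-∘ c#-isHom (IsHom-∘ (F̃-isHom (S-homs h s)) (evh l))

    lo-closed-γ : ∀ d → be Θ d ≡ d → lo Θ (γ (μ X) d) ⊆ γ (μ X) d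
    lo-closed-γ d be-d≡d =
      ≼α⇒⊆γ (lo-homs (λ _ → proj₁)) (subst (_≼ α (lo Θ (γ (μ X) d))) be-d≡d (be-≼-α-lo-γ Θ d))

    module Compatible
      (Λ-compatible : ∀ S → S ⊆ HomsL → ΛL (cl (μ X) S) ⊆ cl (F̃str (μ X)) (ΛL S)) where

      α-lo-≼-be-α : ∀ {S} → S ⊆ HomsL → α (lo Θ S) ≼ be Θ (α S)
      α-lo-≼-be-α {S} S-homs = ∧-greatest
        (≼-trans (α-≼-reindex-α c# (λ g g∈ΛS → inj₁ (g , g∈ΛS , refl)))
                 (reindex-mono c# (⊆γ⇒≼α (Λ-compatible S S-homs))))
        (α-antitone (λ _ → inj₂))

      lo-cl-compatible : ∀ S → S ⊆ HomsL → lo Θ (cl (μ X) S) ⊆ cl (μ X) (lo Θ S)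
      lo-cl-compatible S S-homs = ≼α⇒⊆γ (lo-homs (λ _ → proj₁))
        (≼-trans (α-lo-≼-be-α S-homs) (be-≼-α-lo-γ Θ (α S)))

      α-lfp-gfp : ∀ S → IsLfpL (lo Θ) S → IsGfp (be Θ) (α S)
      α-lfp-gfp S (S-homs , (lo⊆S , S⊆lo) , least) = ≼-antisym be≼ ≼be , greatest
        where
        be≼ : be Θ (α S) ≼ α S
        be≼ = ≼-trans (be-≼-α-lo-γ Θ (α S))
                      (α-antitone (⊆-trans S⊆lo (lo-mono (⊆-cl S-homs))))
        ≼be : α S ≼ be Θ (α S)
        ≼be = ≼-trans (α-antitone lo⊆S) (α-lo-≼-be-α S-homs)
        Lo-homs : Lo Θ ⊆ HomsL
        Lo-homs = Lo-least (lo-homs (λ _ h → h))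
        greatest : ∀ d → be Θ d ≡ d → d ≼ α S
        greatest d be-d≡d = ⊆γ⇒≼α
          (⊆-trans (least (Lo Θ) Lo-homs (Lo-fixpoint Θ)) (Lo-least (lo-closed-γ d be-d≡d)))

      module Transpose (isAlg : IsAlg oΩ) (Θ' : Sub (Hom X Ω)) (Θ≐α'Θ' : Θ ≐ α' Θ') where

        α'-homs : ∀ S → α' S ⊆ HomsL
        α'-homs S k (h , _ , refl) = extend-isHom isAlg h

        α'-mono : ∀ {S S'} → S ⊆ S' → α' S ⊆ α' S'
        α'-mono S⊆S' k (h , s , k≡) = h , S⊆S' h s , k≡

        α'-γ' : ∀ S → α' (γ' S) ⊆ S
        α'-γ' S k (h , s , refl) = s

        γ'-α' : ∀ S → γ' (α' S) ≐ S
        γ'-α' S = (λ { h (h' , s , e) → subst S (sym (extend-injective isAlg e)) s })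
                , (λ h s → h , s , refl)

        lo'-mono : ∀ {S S'} → S ⊆ S' → lo' Θ' S ⊆ lo' Θ' S'
        lo'-mono S⊆S' h (inj₁ (g , (l , h' , s , g≡) , h≡)) = inj₁ (g , (l , h' , S⊆S' h' s , g≡) , h≡)
        lo'-mono S⊆S' h (inj₂ θ') = inj₂ θ'

        transpose-Λ'-c : ∀ l (h : Hom X Ω) →
          oΩ ∘ T₁ ((ev l ∘ (F₁ oΩ ∘ F₁ (T₁ h))) ∘ c) ≡ (ev l ∘ F₁ (oΩ ∘ T₁ h)) ∘ c#
        transpose-Λ'-c l h = begin
          oΩ ∘ T₁ ((ev l ∘ (F₁ oΩ ∘ F₁ (T₁ h))) ∘ c)  ≡⟨ cong (λ z → oΩ ∘ T₁ ((ev l ∘ z) ∘ c)) (sym (F-∘ (T₁ h) oΩ)) ⟩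
          oΩ ∘ T₁ ((ev l ∘ F₁ (oΩ ∘ T₁ h)) ∘ c)       ≡⟨ extend-natural ev∘Fh-isHom c ⟩
          (ev l ∘ F₁ (oΩ ∘ T₁ h)) ∘ (F̃str (μ X) ∘ T₁ c) ≡⟨ cong ((ev l ∘ F₁ (oΩ ∘ T₁ h)) ∘_) c#-extends-c ⟩
          (ev l ∘ F₁ (oΩ ∘ T₁ h)) ∘ c#                ∎
          where
          ev∘Fh-isHom : IsHom (F̃str (μ X)) oΩ (ev l ∘ F₁ (oΩ ∘ T₁ h))
          ev∘Fh-isHom = IsHom-∘ (F̃-isHom (extend-isHom isAlg h)) (evh l)

        α'-lo'-γ'⊆lo : ∀ S → α' (lo' Θ' (γ' S)) ⊆ lo Θ S
        α'-lo'-γ'⊆lo S k (h , inj₂ θ' , k≡) = inj₂ (proj₂ Θ≐α'Θ' k (h , θ' , k≡))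
        α'-lo'-γ'⊆lo S _ (_ , inj₁ (_ , (l , h , s , refl) , refl) , refl) =
          inj₁ (ev l ∘ F₁ (oΩ ∘ T₁ h) , (l , oΩ ∘ T₁ h , s , refl) , transpose-Λ'-c l h)

        lo⊆α'-lo'-γ' : ∀ S → S ⊆ HomsL → lo Θ S ⊆ α' (lo' Θ' (γ' S))
        lo⊆α'-lo'-γ' S S-homs k (inj₂ θ) with proj₁ Θ≐α'Θ' k θ
        ... | h , θ' , k≡ = h , inj₂ θ' , k≡
        lo⊆α'-lo'-γ' S S-homs .((ev l ∘ F₁ h) ∘ c#) (inj₁ (.(ev l ∘ F₁ h) , (l , h , s , refl) , refl)) =
          (ev l ∘ (F₁ oΩ ∘ F₁ (T₁ (h ∘ η X)))) ∘ c ,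
          inj₁ (_ , (l , h ∘ η X , subst S (sym h-restrict) s , refl) , refl) ,
          sym (trans (transpose-Λ'-c l (h ∘ η X)) (cong (λ z → (ev l ∘ F₁ z) ∘ c#) h-restrict))
          where
          h-restrict : oΩ ∘ T₁ (h ∘ η X) ≡ h
          h-restrict = extend-restrict (S-homs h s)

        α'-lo'-γ'≐lo : ∀ S → S ⊆ HomsL → α' (lo' Θ' (γ' S)) ≐ lo Θ S
        α'-lo'-γ'≐lo S S-homs = α'-lo'-γ'⊆lo S , lo⊆α'-lo'-γ' S S-homs

        α'-lfp : ∀ S' → IsLfp (lo' Θ') S' → IsLfpL (lo Θ) (α' S')
        α'-lfp S' ((lo'⊆S' , S'⊆lo') , least') = α'-homs S' , (lo⊆ , ⊆lo) , least
          where
          lo⊆ : lo Θ (α' S') ⊆ α' S'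
          lo⊆ = ⊆-trans (lo⊆α'-lo'-γ' (α' S') (α'-homs S'))
                        (α'-mono (⊆-trans (lo'-mono (proj₁ (γ'-α' S'))) lo'⊆S'))
          ⊆lo : α' S' ⊆ lo Θ (α' S')
          ⊆lo = ⊆-trans (α'-mono (⊆-trans S'⊆lo' (lo'-mono (proj₂ (γ'-α' S')))))
                        (α'-lo'-γ'⊆lo (α' S'))
          least : ∀ S → S ⊆ HomsL → lo Θ S ≐ S → α' S' ⊆ S
          least S S-homs (lo⊆S , S⊆lo) = ⊆-trans (α'-mono (least' (γ' S) (γ'lo⊆ , ⊆γ'lo))) (α'-γ' S)
            where
            γ'lo⊆ : lo' Θ' (γ' S) ⊆ γ' S
            γ'lo⊆ h x = lo⊆S _ (α'-lo'-γ'⊆lo S _ (h , x , refl))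
            ⊆γ'lo : γ' S ⊆ lo' Θ' (γ' S)
            ⊆γ'lo = ⊆-trans (λ h s → lo⊆α'-lo'-γ' S S-homs _ (S⊆lo _ s))
                            (proj₁ (γ'-α' (lo' Θ' (γ' S))))

        α-α'-lfp-gfp : ∀ S' → IsLfp (lo' Θ') S' → IsGfp (be Θ) (α (α' S'))
        α-α'-lfp-gfp S' lfp = α-lfp-gfp (α' S') (α'-lfp S' lfp)

theorem4 : ∀ {o ℓ p : Level} (C : Category o ℓ) (M : Monad C) (Fn : Endofunctor C)
    (Z : EMLaw M Fn) (Ψ : MeetFibration C p)
    (Ω : Category.Obj C) (oΩ : Category.Hom C (Monad.T₀ M Ω) Ω)
    (dΩ : MeetFibration.P Ψ Ω)
    (Λ : Set ℓ) (ev : Λ → Category.Hom C (Endofunctor.F₀ Fn Ω) Ω)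
    (X : Category.Obj C) (c : Category.Hom C X (Endofunctor.F₀ Fn (Monad.T₀ M X))) →
    let open Theory C M Fn Z Ψ Ω oΩ dΩ Λ ev X c in
    IsAlg oΩ →
    (∀ l → IsHom (F̃str oΩ) oΩ (ev l)) →
    (∀ S → S ⊆ HomsL → ΛL (cl (Monad.μ M X) S) ⊆ cl (F̃str (Monad.μ M X)) (ΛL S)) →
    (Θ : Sub (Category.Hom C (Monad.T₀ M X) Ω)) → Θ ⊆ HomsL →
    (∀ S → S ⊆ HomsL → lo Θ (cl (Monad.μ M X) S) ⊆ cl (Monad.μ M X) (lo Θ S))
    × (∀ S → IsLfpL (lo Θ) S → IsGfp (be Θ) (α S))
    × ((Θ' : Sub (Category.Hom C X Ω)) → Θ ≐ α' Θ' →
         (∀ S → S ⊆ HomsL → α' (lo' Θ' (γ' S)) ≐ lo Θ S)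
         × (∀ S' → IsLfp (lo' Θ') S' → IsGfp (be Θ) (α (α' S'))))
theorem4 C M Fn Z Ψ Ω oΩ dΩ Λ ev X c isAlg evh Λ-compatible Θ Θ-homs =
  lo-cl-compatible , α-lfp-gfp ,
  λ Θ' Θ≐α'Θ' → let open Transpose isAlg Θ' Θ≐α'Θ' in α'-lo'-γ'≐lo , α-α'-lfp-gfp
  where
  open Proof C M Fn Z Ψ Ω oΩ dΩ Λ ev X c
  open Homomorphisms evh Θ Θ-homs
  open Compatible Λ-compatible
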